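{- Let $0\le\ell\le 2k-1$. If $G$ is a $(k,\ell)$-pebble-game graph, then $G$ has a canonical pebble game construction.
   Context: A graph means a finite multigraph, possibly with loops. The $(k,\ell)$-pebble game with colors is played on a fixed finite vertex set $V$. Its state is a directed multigraph $H$ on $V$ (loops allowed) together with pebbles, each having one of $k$ colors $c_1,\dots,c_k$. Each pebble lies on a vertex or on an edge, and every edge carries exactly one pebble; the color of an edge is the color of its pebble. Initially $H$ has no edges and each vertex carries one pebble of each color. Moves: (add-edge) Let $v,w$ be vertices, not necessarily distinct, whose set $\{v,w\}$ carries at least $\ell+1$ pebbles in total, with $v$ carrying at least one pebble (relabel if needed). Pick up a pebble from $v$, add the directed edge $vw$, and put that pebble on it. (pebble-slide) Let $w$ carry a pebble $p$ and let $vw$ be an edge. Replace $vw$ by $wv$, put the pebble from $vw$ onto $v$, and put $p$ on $wv$. $G$ is a $(k,\ell)$-pebble-game graph if it is the underlying undirected graph of the final directed graph of some finite sequence of moves (a pebble game construction) starting from the initial configuration on $V(G)$. A monochromatic cycle is a cycle (loops and parallel pairs included) in the undirected graph formed by the edges of a single color. A canonical add-edge move is an add-edge move between $v$ and $w$ in which the new edge is covered by a pebble of a color present on both $v$ and $w$, if such a color exists; otherwise it is covered by a pebble of the highest-numbered color present on $v$ or $w$. In either case the edge is directed away from the vertex whose pebble is used. A canonical pebble-slide move is a pebble-slide move that does not create a monochromatic cycle. A canonical pebble game construction uses only canonical add-edge and canonical pebble-slide moves. -}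

module Defs where

open import Data.Nat as ℕ using (ℕ; zero; suc; _+_; _∸_; _≤_; _<_; _*_)
open import Data.Fin as Fin using (Fin; toℕ)
open import Data.Fin.Properties using (_≟_)
open import Data.List using (List; []; _∷_; _++_; map; allFin)
open import Data.Nat.ListAction using (sum)
open import Data.List.Membership.Propositional using (_∈_)
open import Data.List.Relation.Binary.Permutation.Propositional using (_↭_)
open import Data.Product using (_×_; _,_; ∃; ∃-syntax; Σ-syntax)
open import Data.Sum using (_⊎_)
open import Data.Bool using (if_then_else_; _∧_)
open import Relation.Nullary using (¬_)
open import Relation.Nullary.Decidable using (⌊_⌋)
open import Relation.Binary.PropositionalEquality using (_≡_; _≢_)
open import Relation.Binary.Construct.Closure.ReflexiveTransitive using (Star)

-- Vertices are Fin n, colors c₁,…,c_k are Fin k (cᵢ ↔ index i-1, so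
-- "higher-numbered" = larger Fin).

DEdge : ℕ → ℕ → Set
DEdge n k = Fin n × Fin n × Fin k

-- State of the pebble game with colors: number of pebbles of each color
-- on each vertex, and the directed multigraph H as a list of edges, each
-- edge recording the color of the (unique) pebble on it.
record State (n k : ℕ) : Set where
  constructor st
  field
    peb   : Fin n → Fin k → ℕ
    edges : List (DEdge n k)
open State public

initial : ∀ {n k} → State n k
initial = st (λ _ _ → 1) []

addP : ∀ {n k} → Fin n → Fin k → (Fin n → Fin k → ℕ) → Fin n → Fin k → ℕ
addP v c f u d = if ⌊ u ≟ v ⌋ ∧ ⌊ d ≟ c ⌋ then suc (f u d) else f u d

remP : ∀ {n k} → Fin n → Fin k → (Fin n → Fin k → ℕ) → Fin n → Fin k → ℕ
remP v c f u d = if ⌊ u ≟ v ⌋ ∧ ⌊ d ≟ c ⌋ then f u d ∸ 1 else f u d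

Present : ∀ {n k} → (Fin n → Fin k → ℕ) → Fin n → Fin k → Set
Present f v c = 1 ≤ f v c

count : ∀ {n k} → (Fin n → Fin k → ℕ) → Fin n → ℕ
count {k = k} f v = sum (map (f v) (allFin k))

countSet : ∀ {n k} → (Fin n → Fin k → ℕ) → Fin n → Fin n → ℕ
countSet f v w = if ⌊ v ≟ w ⌋ then count f v else count f v + count f w

-- Add-edge move with source v (whose pebble of color c is used) and
-- target w.  ("relabel if needed": both orientations arise by choosing v.)
record AddEdge {n k} (ℓ : ℕ) (s s' : State n k) : Set where
  field
    v w    : Fin n
    c      : Fin k
    onV    : Present (peb s) v c
    enough : ℓ + 1 ≤ countSet (peb s) v w
    newPeb : peb s' ≡ remP v c (peb s)
    newE   : edges s' ≡ (v , w , c) ∷ edges s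

record Slide {n k} (s s' : State n k) : Set where
  field
    E₁ E₂  : List (DEdge n k)
    v w    : Fin n
    c c'   : Fin k
    oldE   : edges s ≡ E₁ ++ (v , w , c) ∷ E₂
    onW    : Present (peb s) w c'
    newPeb : peb s' ≡ addP v c (remP w c' (peb s))
    newE   : edges s' ≡ E₁ ++ (w , v , c') ∷ E₂

data Step {n k} (ℓ : ℕ) (s s' : State n k) : Set where
  add   : AddEdge ℓ s s' → Step ℓ s s'
  slide : Slide s s' → Step ℓ s s'

data Walk {n k} (E : List (DEdge n k)) (c : Fin k) : Fin n → Fin n → Set where
  here : ∀ {x} → Walk E c x x
  fwd  : ∀ {x y z} → (x , y , c) ∈ E → Walk E c y z → Walk E c x z
  bwd  : ∀ {x y z} → (y , x , c) ∈ E → Walk E c y z → Walk E c x z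

-- The slide replacing vw by wv (colored c') creates a monochromatic cycle
-- iff the new edge wv lies on a cycle of color c' in the new graph, i.e.
-- it is a loop, or w and v are joined by a c'-colored walk avoiding it.
CreatesMonoCycle : ∀ {n k} {s s' : State n k} → Slide s s' → Set
CreatesMonoCycle sl = (v ≡ w) ⊎ Walk (E₁ ++ E₂) c' w v
  where open Slide sl

record CanonAddEdge {n k} (ℓ : ℕ) (s s' : State n k) : Set where
  field
    move  : AddEdge ℓ s s'
  open AddEdge move
  field
    canon : Present (peb s) w c
          ⊎ ((∀ d → ¬ (Present (peb s) v d × Present (peb s) w d))
             × (∀ d → Present (peb s) v d ⊎ Present (peb s) w d → d Fin.≤ c))

record CanonSlide {n k} (s s' : State n k) : Set where
  field
    move    : Slide s s'
    noCycle : ¬ CreatesMonoCycle move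

data CanonStep {n k} (ℓ : ℕ) (s s' : State n k) : Set where
  add   : CanonAddEdge ℓ s s' → CanonStep ℓ s s'
  slide : CanonSlide s s' → CanonStep ℓ s s'

-- Undirected graphs on Fin n: finite multigraphs with loops, as lists of
-- edges; two such are equal iff equal as multisets of unordered pairs.
norm : ∀ {n} → Fin n × Fin n → Fin n × Fin n
norm (v , w) = if ⌊ toℕ v ℕ.≤? toℕ w ⌋ then (v , w) else (w , v)

underlying : ∀ {n k} → State n k → List (Fin n × Fin n)
underlying s = map (λ { (v , w , _) → (v , w) }) (edges s)

SameGraph : ∀ {n} → List (Fin n × Fin n) → List (Fin n × Fin n) → Set
SameGraph G H = map norm G ↭ map norm H

PebbleGameGraph : ∀ {n} (k ℓ : ℕ) → List (Fin n × Fin n) → Set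
PebbleGameGraph {n} k ℓ G =
  ∃[ s ] (Star (Step {n} {k} ℓ) initial s × SameGraph (underlying s) G)

HasCanonicalConstruction : ∀ {n} (k ℓ : ℕ) → List (Fin n × Fin n) → Set
HasCanonicalConstruction {n} k ℓ G =
  ∃[ s ] (Star (CanonStep {n} {k} ℓ) initial s × SameGraph (underlying s) G)

-- Pebble-slides do not change the underlying graph, so it suffices to follow
-- the given construction and to replace each of its add-edge moves vw by
-- canonical moves on a configuration with the same underlying graph.
--
-- Every pebble lies either on its vertex or on an edge leaving that vertex,
-- with the same colour.  Hence, for each colour c, the c-coloured edges are
-- the graph of a partial map whose undefined points are the vertices carrying
-- a c-pebble.  A pebble sitting at the end z of a directed path can be brought
-- back to the start of the path by canonical slides: choose a colour c on z,
-- walk down the path to the first vertex of the c-tree of z, bring the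
-- c-pebble of z down the tree to that vertex, and reverse the edge entering
-- it.  A reversal never closes a monochromatic cycle, because the tail of the
-- reversed edge is not in the c-tree of its head.
--
-- If no pebble outside {v, w} can be reached from {v, w} in this way, the
-- vertices reachable from {v, w} form a set X that no edge leaves and that
-- carries no pebbles outside {v, w}.  On any vertex set, pebbles plus
-- out-edges number k per vertex, and edges inside X depend only on the
-- underlying graph; so the original configuration has at most as many
-- pebbles on X, hence on {v, w}, as the canonical one.  Thus pebbles can be
-- gathered on {v, w} until the add-edge move is possible, and it is then
-- performed canonically.

module Submission where

open import Algebra.Properties.CommutativeSemigroup using (x∙yz≈y∙xz; xy∙z≈xz∙y)
open import Data.Bool.Base using (Bool; true; false; if_then_else_; _∧_; _∨_; not)
open import Data.Bool.Properties using (∧-comm; ∨-idem) renaming (_≟_ to _≟ᵇ_)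
open import Data.Empty using (⊥-elim)
open import Data.Fin.Base as Fin using (Fin; zero; suc; toℕ)
open import Data.Fin.Properties using (_≟_; pigeonhole; toℕ<n; toℕ-injective) renaming (any? to anyFin?)
open import Data.List.Base using (List; []; _∷_; _++_; map; tabulate)
open import Data.List.Properties using (map-tabulate; map-∘; map-++)
open import Data.List.Membership.Propositional using (_∈_; find; lose)
open import Data.List.Membership.Propositional.Properties using (∈-∃++; ∈-++⁺ˡ; ∈-++⁺ʳ; ∈-++⁻)
open import Data.List.Relation.Unary.Any using (here; there; any?)
open import Data.List.Relation.Binary.Permutation.Propositional as Perm
  using (_↭_; prep; ↭-refl; ↭-trans; ↭-sym; ↭-reflexive)
import Data.Nat.ListAction as List
open import Data.Nat.Base using (ℕ; zero; suc; _+_; _∸_; _*_; _≤_; _<_; z≤n; s≤s; z<s)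
open import Data.Nat.GeneralisedArithmetic using (iterate)
open import Data.Nat.Induction using (<-rec)
open import Data.Nat.Properties hiding (_≟_)
open import Algebra.Properties.CommutativeMonoid.Sum +-0-commutativeMonoid
  using (sum; sum-cong-≗; ∑-distrib-+)
open import Data.Product using (_×_; _,_; ∃; ∃₂; Σ-syntax; proj₂; map₂) renaming (map to Σ-map)
open import Data.Sum using (_⊎_; inj₁; inj₂; [_,_]′) renaming (map₁ to ⊎-map₁; map₂ to ⊎-map₂; swap to ⊎-swap)
open import Function.Base using (id; _∘_)
open import Relation.Binary.Definitions using (DecidableEquality)
open import Relation.Binary.PropositionalEquality
open import Relation.Binary.Construct.Closure.ReflexiveTransitive as Star using (Star; ε; _◅_; _◅◅_)
open import Relation.Nullary using (¬_; yes; no; contradiction)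
open import Relation.Nullary.Decidable using (⌊_⌋; _×-dec_; _⊎-dec_; isYes≗does; dec-true)
open import Relation.Unary using (Decidable)

open import Defs

χ : Bool → ℕ
χ true  = 1
χ false = 0

χ≤1 : ∀ b → χ b ≤ 1
χ≤1 true  = ≤-refl
χ≤1 false = z≤n

χ-∧ : ∀ b c → χ (b ∧ c) ≡ (if c then χ b else 0)
χ-∧ true  true  = refl
χ-∧ true  false = refl
χ-∧ false true  = refl
χ-∧ false false = refl

χ-∧-≤ : ∀ b c → χ (b ∧ c) ≤ χ b
χ-∧-≤ true  c = χ≤1 c
χ-∧-≤ false c = z≤n

-- One vertex and colour under an add-edge move (withdraw) and a slide
-- (exchange): a pebble leaves iff b (resp. b₂), one arrives iff b₁, and r
-- counts the remaining out-edges.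
withdraw : ∀ b a r → (b ≡ true → 1 ≤ a) → a + r ≡ 1 → (if b then a ∸ 1 else a) + (χ b + r) ≡ 1
withdraw true  (suc a) r _   eq = trans (+-suc a r) eq
withdraw true  zero    r pos _  with () ← pos refl
withdraw false a       r _   eq = eq

exchange : ∀ b₁ b₂ a → (b₂ ≡ true → 1 ≤ a) →
           (if b₁ then suc (if b₂ then a ∸ 1 else a) else (if b₂ then a ∸ 1 else a)) + χ b₂ ≡ a + χ b₁
exchange true  true  (suc a) _   = refl
exchange true  true  zero    pos with () ← pos refl
exchange true  false a       _   = trans (cong suc (+-identityʳ a)) (+-comm 1 a)
exchange false true  (suc a) _   = trans (+-comm a 1) (sym (+-identityʳ (suc a)))
exchange false true  zero    pos with () ← pos refl
exchange false false a       _   = refl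

+-cancel-chain : ∀ p q r a b c → q + a ≡ p + b → r + b ≡ q + c → r + a ≡ p + c
+-cancel-chain p q r a b c qa≡pb rb≡qc = +-cancelʳ-≡ b (r + a) (p + c) (begin
  r + a + b  ≡⟨ xy∙z≈xz∙y +-commutativeSemigroup r a b ⟩
  r + b + a  ≡⟨ cong (_+ a) rb≡qc ⟩
  q + c + a  ≡⟨ xy∙z≈xz∙y +-commutativeSemigroup q c a ⟩
  q + a + c  ≡⟨ cong (_+ c) qa≡pb ⟩
  p + b + c  ≡⟨ xy∙z≈xz∙y +-commutativeSemigroup p b c ⟩
  p + c + b  ∎)
  where open ≡-Reasoning

⌊≟⌋-diag : ∀ {m} (x : Fin m) → ⌊ x ≟ x ⌋ ≡ true
⌊≟⌋-diag x = trans (isYes≗does (x ≟ x)) (dec-true (x ≟ x) refl)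

⌊≟⌋-true : ∀ {m} {x y : Fin m} → ⌊ x ≟ y ⌋ ≡ true → x ≡ y
⌊≟⌋-true {x = x} {y} eq with x ≟ y
... | yes x≡y = x≡y

⌊suc≟suc⌋ : ∀ {m} (i a : Fin m) → ⌊ suc i ≟ suc a ⌋ ≡ ⌊ i ≟ a ⌋
⌊suc≟suc⌋ i a with i ≟ a
... | yes _ = refl
... | no  _ = refl

sum-zero : ∀ m → sum {m} (λ _ → 0) ≡ 0
sum-zero zero    = refl
sum-zero (suc m) = sum-zero m

sum-ones : ∀ m → sum {m} (λ _ → 1) ≡ m
sum-ones zero    = refl
sum-ones (suc m) = cong suc (sum-ones m)

sum-mono-≤ : ∀ {m} {f g : Fin m → ℕ} → (∀ i → f i ≤ g i) → sum f ≤ sum g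
sum-mono-≤ {zero}  f≤g = z≤n
sum-mono-≤ {suc m} f≤g = +-mono-≤ (f≤g zero) (sum-mono-≤ (f≤g ∘ suc))

sum-mono-< : ∀ {m} {f g : Fin m → ℕ} → (∀ i → f i ≤ g i) → ∀ i → f i < g i → sum f < sum g
sum-mono-< f≤g zero    fi<gi = +-mono-<-≤ fi<gi (sum-mono-≤ (f≤g ∘ suc))
sum-mono-< f≤g (suc i) fi<gi = +-mono-≤-< (f≤g zero) (sum-mono-< (f≤g ∘ suc) i fi<gi)

≤-sum : ∀ {m} (f : Fin m → ℕ) i → f i ≤ sum f
≤-sum f zero    = m≤m+n _ _
≤-sum f (suc i) = ≤-trans (≤-sum (f ∘ suc) i) (m≤n+m _ _)

sum-positive : ∀ {m} (f : Fin m → ℕ) → 1 ≤ sum f → ∃ λ i → 1 ≤ f i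
sum-positive {suc m} f pos with f zero in eq
... | suc _ = zero , subst (1 ≤_) (sym eq) (s≤s z≤n)
... | zero  = Σ-map suc id (sum-positive (f ∘ suc) pos)

sum-δ : ∀ {m} (a : Fin m) (f : Fin m → ℕ) → sum (λ i → if ⌊ i ≟ a ⌋ then f i else 0) ≡ f a
sum-δ {suc m} zero    f = trans (cong (f zero +_) (sum-zero m)) (+-identityʳ (f zero))
sum-δ {suc m} (suc a) f =
  trans (sum-cong-≗ (λ i → cong (λ b → if b then f (suc i) else 0) (⌊suc≟suc⌋ i a)))
        (sum-δ a (f ∘ suc))

sum-tabulate : ∀ {m} (f : Fin m → ℕ) → List.sum (tabulate f) ≡ sum f
sum-tabulate {zero}  f = refl
sum-tabulate {suc m} f = cong (f zero +_) (sum-tabulate (f ∘ suc))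

count≡sum : ∀ {n k} (f : Fin n → Fin k → ℕ) x → count f x ≡ sum (f x)
count≡sum f x = trans (cong List.sum (map-tabulate id (f x))) (sum-tabulate (f x))

count-≥ : ∀ {n k} (f : Fin n → Fin k → ℕ) x c → 1 ≤ f x c → 1 ≤ count f x
count-≥ f x c pos = subst (1 ≤_) (sym (count≡sum f x)) (≤-trans pos (≤-sum (f x) c))

max-such-that : ∀ {m} {P : Fin m → Set} → Decidable P → ∃ P →
                ∃ λ d → P d × ∀ d' → P d' → d' Fin.≤ d
max-such-that {suc m} {P} P? some with anyFin? (P? ∘ suc)
... | yes some' with max-such-that (P? ∘ suc) some'
...   | d , Pd , top = suc d , Pd , λ { zero _ → z≤n ; (suc d') Pd' → s≤s (top d' Pd') }
max-such-that {suc m} {P} P? (zero , P0)   | no none =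
  zero , P0 , λ { zero _ → z≤n ; (suc d') Pd' → ⊥-elim (none (d' , Pd')) }
max-such-that {suc m} {P} P? (suc d , Pd) | no none = ⊥-elim (none (d , Pd))

tally : ∀ {A : Set} → (A → Bool) → List A → ℕ
tally p []       = 0
tally p (x ∷ xs) = χ (p x) + tally p xs

module _ {A : Set} where

  tally-remove : ∀ (p : A → Bool) xs a ys → tally p (xs ++ a ∷ ys) ≡ χ (p a) + tally p (xs ++ ys)
  tally-remove p []       a ys = refl
  tally-remove p (x ∷ xs) a ys =
    trans (cong (χ (p x) +_) (tally-remove p xs a ys))
          (x∙yz≈y∙xz +-commutativeSemigroup (χ (p x)) (χ (p a)) _)

  tally-false : ∀ xs → tally {A} (λ _ → false) xs ≡ 0
  tally-false []       = refl
  tally-false (x ∷ xs) = tally-false xs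

  tally-cong : ∀ {p q : A → Bool} xs → (∀ x → x ∈ xs → p x ≡ q x) → tally p xs ≡ tally q xs
  tally-cong []       p≡q = refl
  tally-cong (x ∷ xs) p≡q = cong₂ _+_ (cong χ (p≡q x (here refl))) (tally-cong xs (λ y → p≡q y ∘ there))

  tally-mono : ∀ {p q : A → Bool} → (∀ x → χ (p x) ≤ χ (q x)) → ∀ xs → tally p xs ≤ tally q xs
  tally-mono p≤q []       = z≤n
  tally-mono p≤q (x ∷ xs) = +-mono-≤ (p≤q x) (tally-mono p≤q xs)

  tally-map : ∀ {B : Set} (p : B → Bool) (f : A → B) xs → tally p (map f xs) ≡ tally (p ∘ f) xs
  tally-map p f []       = refl
  tally-map p f (x ∷ xs) = cong (χ (p (f x)) +_) (tally-map p f xs)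

  tally-↭ : ∀ (p : A → Bool) {xs ys} → xs ↭ ys → tally p xs ≡ tally p ys
  tally-↭ p Perm.refl          = refl
  tally-↭ p (Perm.prep x xs↭ys) = cong (χ (p x) +_) (tally-↭ p xs↭ys)
  tally-↭ p (Perm.swap x y xs↭ys) =
    trans (x∙yz≈y∙xz +-commutativeSemigroup (χ (p x)) (χ (p y)) _)
          (cong (λ t → χ (p y) + (χ (p x) + t)) (tally-↭ p xs↭ys))
  tally-↭ p (Perm.trans xs↭ys ys↭zs) = trans (tally-↭ p xs↭ys) (tally-↭ p ys↭zs)

  tally-∈ : ∀ (p : A → Bool) {x xs} → x ∈ xs → p x ≡ true → 1 ≤ tally p xs
  tally-∈ p (here refl) px rewrite px = s≤s z≤n
  tally-∈ p (there mem) px = ≤-trans (tally-∈ p mem px) (m≤n+m _ _)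

  ∈-++-insert : ∀ xs {a ys} {e : A} → e ∈ xs ++ ys → e ∈ xs ++ a ∷ ys
  ∈-++-insert xs mem = [ ∈-++⁺ˡ , ∈-++⁺ʳ xs ∘ there ]′ (∈-++⁻ xs mem)

  ∈-++-replace : ∀ xs {a b ys} {e : A} → e ∈ xs ++ a ∷ ys → e ≡ a ⊎ e ∈ xs ++ b ∷ ys
  ∈-++-replace xs mem with ∈-++⁻ xs mem
  ... | inj₁ e∈xs         = inj₂ (∈-++⁺ˡ e∈xs)
  ... | inj₂ (here e≡a)   = inj₁ e≡a
  ... | inj₂ (there e∈ys) = inj₂ (∈-++⁺ʳ xs (there e∈ys))

sum-tally : ∀ {A : Set} {m} (f : A → Fin m) (r : Fin m → A → Bool) xs →
            sum (λ d → tally (λ e → r d e ∧ ⌊ d ≟ f e ⌋) xs) ≡ tally (λ e → r (f e) e) xs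
sum-tally {m = m} f r []       = sum-zero m
sum-tally         f r (e ∷ xs) =
  trans (∑-distrib-+ (λ d → χ (r d e ∧ ⌊ d ≟ f e ⌋)) (λ d → tally (λ e → r d e ∧ ⌊ d ≟ f e ⌋) xs))
        (cong₂ _+_ (trans (sum-cong-≗ (λ d → χ-∧ (r d e) ⌊ d ≟ f e ⌋)) (sum-δ (f e) (λ d → χ (r d e))))
                   (sum-tally f r xs))

-- Orbits of a function

module Iteration {A : Set} (f : A → A) where

  Reaches : A → A → Set
  Reaches x z = ∃ λ m → iterate f x m ≡ z

  iterate-+ : ∀ x m p → iterate f x (m + p) ≡ iterate f (iterate f x m) p
  iterate-+ x zero    p = refl
  iterate-+ x (suc m) p = iterate-+ (f x) m p

  iterate-fixed : ∀ {z} → f z ≡ z → ∀ m → iterate f z m ≡ z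
  iterate-fixed fz zero    = refl
  iterate-fixed fz (suc m) = trans (cong (λ y → iterate f y m) fz) (iterate-fixed fz m)

  Reaches-iterate : ∀ {x z m i} → i ≤ m → iterate f x m ≡ z → Reaches (iterate f x i) z
  Reaches-iterate {x} {m = m} {i} i≤m hit =
    m ∸ i , trans (sym (iterate-+ x i (m ∸ i))) (trans (cong (iterate f x) (m+[n∸m]≡n i≤m)) hit)

  iterate-stays : ∀ {z} → f z ≡ z → ∀ x {m p} → m ≤ p → iterate f x m ≡ z → iterate f x p ≡ z
  iterate-stays {z} fz x {m} {p} m≤p hit = begin
    iterate f x p                      ≡⟨ cong (iterate f x) (sym (m+[n∸m]≡n m≤p)) ⟩
    iterate f x (m + (p ∸ m))          ≡⟨ iterate-+ x m (p ∸ m) ⟩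
    iterate f (iterate f x m) (p ∸ m)  ≡⟨ cong (λ y → iterate f y (p ∸ m)) hit ⟩
    iterate f z (p ∸ m)                ≡⟨ iterate-fixed fz (p ∸ m) ⟩
    z                                  ∎
    where open ≡-Reasoning

  first-hit : DecidableEquality A → ∀ x {z} m → iterate f x m ≡ z →
              ∃ λ m' → iterate f x m' ≡ z × (∀ i → i < m' → iterate f x i ≢ z)
  first-hit _≟A_ x zero    hit = 0 , hit , λ _ ()
  first-hit _≟A_ x {z} (suc m) hit with x ≟A z
  ... | yes x≡z = 0 , x≡z , λ _ ()
  ... | no  x≢z with first-hit _≟A_ (f x) m hit
  ...   | m' , hit' , miss = suc m' , hit' , λ { zero _ → x≢z ; (suc i) i<m' → miss i (≤-pred i<m') }

open Iteration

-- Pigeonhole: the orbit of x visits some point twice within n steps, and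
-- cutting out the cycle shortens any longer route to the fixed point z.
iterate-within : ∀ {n} (f : Fin n → Fin n) {z} → f z ≡ z → ∀ x m → iterate f x m ≡ z → iterate f x n ≡ z
iterate-within {n} f {z} fz x = <-rec (λ m → iterate f x m ≡ z → iterate f x n ≡ z) shortcut
  where
  shortcut : ∀ m → (∀ {m'} → m' < m → iterate f x m' ≡ z → iterate f x n ≡ z) →
             iterate f x m ≡ z → iterate f x n ≡ z
  shortcut m rec hit with m ≤? n
  ... | yes m≤n = iterate-stays f fz x m≤n hit
  ... | no  m≰n with pigeonhole (n<1+n n) (λ (i : Fin (suc n)) → iterate f x (toℕ i))
  ...   | i , j , i<j , same = rec shorter (begin
            iterate f x (toℕ i + (m ∸ toℕ j))          ≡⟨ iterate-+ f x (toℕ i) (m ∸ toℕ j) ⟩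
            iterate f (iterate f x (toℕ i)) (m ∸ toℕ j) ≡⟨ cong (λ y → iterate f y (m ∸ toℕ j)) same ⟩
            iterate f (iterate f x (toℕ j)) (m ∸ toℕ j) ≡⟨ sym (iterate-+ f x (toℕ j) (m ∸ toℕ j)) ⟩
            iterate f x (toℕ j + (m ∸ toℕ j))          ≡⟨ cong (iterate f x) (m+[n∸m]≡n j≤m) ⟩
            iterate f x m                              ≡⟨ hit ⟩
            z                                          ∎)
    where
    open ≡-Reasoning
    j≤m : toℕ j ≤ m
    j≤m = ≤-trans (≤-pred (toℕ<n j)) (<⇒≤ (≰⇒> m≰n))
    shorter : toℕ i + (m ∸ toℕ j) < m
    shorter = subst (toℕ i + (m ∸ toℕ j) <_) (m+[n∸m]≡n j≤m) (+-monoˡ-< (m ∸ toℕ j) i<j)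

module Game (n k : ℕ) where

  Vertex = Fin n
  Colour = Fin k
  Edge   = DEdge n k
  Config = State n k

  src tgt : Edge → Vertex
  src (v , _ , _) = v
  tgt (_ , w , _) = w

  col : Edge → Colour
  col (_ , _ , c) = c

  edgeNorm : Edge → Vertex × Vertex
  edgeNorm e = norm (src e , tgt e)

  isOut : Vertex → Colour → Edge → Bool
  isOut x d (v , _ , c) = ⌊ x ≟ v ⌋ ∧ ⌊ d ≟ c ⌋

  outdeg : Vertex → Colour → List Edge → ℕ
  outdeg x d = tally (isOut x d)

  -- Each of the pebbles a vertex starts with is either still on it or on
  -- exactly one edge leaving it, with its colour.
  record Balanced (s : Config) : Set where
    constructor balanced
    field balance : ∀ x d → peb s x d + outdeg x d (edges s) ≡ 1
  open Balanced

  pebble-at : ∀ (f : Vertex → Colour → ℕ) {v c} → Present f v c →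
              ∀ x d → ⌊ x ≟ v ⌋ ∧ ⌊ d ≟ c ⌋ ≡ true → 1 ≤ f x d
  pebble-at f {v} {c} pos x d hit with x ≟ v | d ≟ c
  ... | yes refl | yes refl = pos

  addP-here : ∀ (f : Vertex → Colour → ℕ) v d → 1 ≤ addP v d f v d
  addP-here f v d rewrite ⌊≟⌋-diag v | ⌊≟⌋-diag d = s≤s z≤n

  Balanced-initial : Balanced initial
  Balanced-initial = balanced λ _ _ → refl

  Balanced-add : ∀ {ℓ s s'} → AddEdge ℓ s s' → Balanced s → Balanced s'
  Balanced-add {s = s} {s'} mv bal = balanced balance'
    where
    open AddEdge mv
    balance' : ∀ x d → peb s' x d + outdeg x d (edges s') ≡ 1
    balance' x d rewrite newPeb | newE =
      withdraw (⌊ x ≟ v ⌋ ∧ ⌊ d ≟ c ⌋) (peb s x d) _ (pebble-at (peb s) onV x d) (balance bal x d)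

  Balanced-slide : ∀ {s s'} → Slide s s' → Balanced s → Balanced s'
  Balanced-slide {s} {s'} sl bal = balanced balance'
    where
    open Slide sl
    open ≡-Reasoning
    balance' : ∀ x d → peb s' x d + outdeg x d (edges s') ≡ 1
    balance' x d = begin
        peb s' x d + outdeg x d (edges s')
          ≡⟨ cong₂ (λ f E → f x d + outdeg x d E) newPeb newE ⟩
        p' + outdeg x d (E₁ ++ (w , v , c') ∷ E₂)
          ≡⟨ cong (p' +_) (tally-remove (isOut x d) E₁ _ E₂) ⟩
        p' + (χ (isOut x d (w , v , c')) + rest)
          ≡⟨ sym (+-assoc p' _ rest) ⟩
        p' + χ (isOut x d (w , v , c')) + rest
          ≡⟨ cong (_+ rest) (exchange _ _ (peb s x d) (pebble-at (peb s) onW x d)) ⟩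
        peb s x d + χ (isOut x d (v , w , c)) + rest
          ≡⟨ +-assoc (peb s x d) _ rest ⟩
        peb s x d + (χ (isOut x d (v , w , c)) + rest)
          ≡⟨ cong (peb s x d +_) (sym (tally-remove (isOut x d) E₁ _ E₂)) ⟩
        peb s x d + outdeg x d (E₁ ++ (v , w , c) ∷ E₂)
          ≡⟨ cong (λ E → peb s x d + outdeg x d E) (sym oldE) ⟩
        peb s x d + outdeg x d (edges s)
          ≡⟨ balance bal x d ⟩
        1 ∎
      where
      p'   = addP v c (remP w c' (peb s)) x d
      rest = outdeg x d (E₁ ++ E₂)

  Balanced-step : ∀ {ℓ s s'} → Step ℓ s s' → Balanced s → Balanced s'
  Balanced-step (add mv)   = Balanced-add mv
  Balanced-step (slide sl) = Balanced-slide sl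

  Slides : Config → Config → Set
  Slides = Star (CanonSlide {n} {k})

  Balanced-slides : ∀ {s s'} → Slides s s' → Balanced s → Balanced s'
  Balanced-slides ε          bal = bal
  Balanced-slides (sl ◅ sls) bal = Balanced-slides sls (Balanced-slide (CanonSlide.move sl) bal)

  outdeg≤1 : ∀ {s} → Balanced s → ∀ x d → outdeg x d (edges s) ≤ 1
  outdeg≤1 {s} bal x d = subst (outdeg x d (edges s) ≤_) (balance bal x d) (m≤n+m _ (peb s x d))

  pebble⇒outdeg≡0 : ∀ {s} → Balanced s → ∀ {x d} → 1 ≤ peb s x d → outdeg x d (edges s) ≡ 0
  pebble⇒outdeg≡0 {s} bal {x} {d} pos with peb s x d | balance bal x d
  ... | suc a | eq = m+n≡0⇒n≡0 a (suc-injective eq)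

  outdeg-remove : ∀ {E E₁ E₂ e} → E ≡ E₁ ++ e ∷ E₂ →
                  ∀ x d → outdeg x d E ≡ χ (isOut x d e) + outdeg x d (E₁ ++ E₂)
  outdeg-remove {E₁ = E₁} {E₂} {e} refl x d = tally-remove (isOut x d) E₁ e E₂

  norm-swap : ∀ (v w : Vertex) → norm (v , w) ≡ norm (w , v)
  norm-swap v w with toℕ v ≤? toℕ w | toℕ w ≤? toℕ v
  ... | yes v≤w | yes w≤v with refl ← toℕ-injective (≤-antisym v≤w w≤v) = refl
  ... | yes _   | no  _   = refl
  ... | no  _   | yes _   = refl
  ... | no  v≰w | no  w≰v = contradiction (≰⇒≥ w≰v) v≰w

  underlying-norm : ∀ s → map norm (underlying s) ≡ map edgeNorm (edges s)
  underlying-norm s = sym (map-∘ (edges s))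

  Slide-sameGraph : ∀ {s s'} → Slide s s' → SameGraph (underlying s') (underlying s)
  Slide-sameGraph {s} {s'} sl = ↭-reflexive (begin
      map norm (underlying s')                           ≡⟨ underlying-norm s' ⟩
      map edgeNorm (edges s')                            ≡⟨ cong (map edgeNorm) newE ⟩
      map edgeNorm (E₁ ++ (w , v , c') ∷ E₂)             ≡⟨ map-++ edgeNorm E₁ _ ⟩
      map edgeNorm E₁ ++ norm (w , v) ∷ map edgeNorm E₂  ≡⟨ cong (λ p → map edgeNorm E₁ ++ p ∷ map edgeNorm E₂)
                                                                (norm-swap w v) ⟩
      map edgeNorm E₁ ++ norm (v , w) ∷ map edgeNorm E₂  ≡⟨ sym (map-++ edgeNorm E₁ _) ⟩
      map edgeNorm (E₁ ++ (v , w , c) ∷ E₂)              ≡⟨ cong (map edgeNorm) (sym oldE) ⟩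
      map edgeNorm (edges s)                             ≡⟨ sym (underlying-norm s) ⟩
      map norm (underlying s)                            ∎)
    where
    open Slide sl
    open ≡-Reasoning

  Slides-sameGraph : ∀ {s s'} → Slides s s' → SameGraph (underlying s') (underlying s)
  Slides-sameGraph ε          = ↭-refl
  Slides-sameGraph (sl ◅ sls) = ↭-trans (Slides-sameGraph sls) (Slide-sameGraph (CanonSlide.move sl))

  -- Colour trees

  -- In a balanced configuration a vertex has at most one out-edge of colour c,
  -- and none if it carries a c-pebble; the vertices without one are the fixed
  -- points of parent c.
  parent : Colour → List Edge → Vertex → Vertex
  parent c []      x = x
  parent c (e ∷ E) x = if isOut x c e then tgt e else parent c E x

  isOut-self : ∀ x y c → isOut x c (x , y , c) ≡ true
  isOut-self x y c = cong₂ _∧_ (⌊≟⌋-diag x) (⌊≟⌋-diag c)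

  parent-edge : ∀ {c E x y} → (x , y , c) ∈ E → outdeg x c E ≤ 1 → parent c E x ≡ y
  parent-edge {c} {x = x} {y} (here refl) _ rewrite isOut-self x y c = refl
  parent-edge {c} {e ∷ E} {x} {y} (there mem) deg with isOut x c e
  ... | true  = contradiction (≤-trans (s≤s (tally-∈ (isOut x c) mem (isOut-self x y c))) deg) 1+n≰n
  ... | false = parent-edge mem deg

  parent-root : ∀ {c} E {x} → outdeg x c E ≡ 0 → parent c E x ≡ x
  parent-root []           _   = refl
  parent-root {c} (e ∷ E) {x} deg with isOut x c e
  ... | false = parent-root E deg

  parent-∈ : ∀ {c} E x → parent c E x ≡ x ⊎ (x , parent c E x , c) ∈ E
  parent-∈ []                  x = inj₁ refl
  parent-∈ {c} ((a , b , d) ∷ E) x with x ≟ a | c ≟ d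
  ... | yes refl | yes refl = inj₂ (here refl)
  ... | yes _    | no _     = ⊎-map₂ there (parent-∈ E x)
  ... | no _     | _        = ⊎-map₂ there (parent-∈ E x)

  -- Every c-edge joins a vertex to its parent, so an undirected c-walk cannot
  -- leave the tree of a root.
  walk-reaches : ∀ {E c z} → (∀ x → outdeg x c E ≤ 1) → parent c E z ≡ z →
                 ∀ {x y} → Walk E c x y → Reaches (parent c E) x z → Reaches (parent c E) y z
  walk-reaches deg root here r = r
  walk-reaches deg root (fwd mem walk) (zero , refl) =
    walk-reaches deg root walk (0 , trans (sym (parent-edge mem (deg _))) root)
  walk-reaches {E} {c} deg root (fwd mem walk) (suc m , hit) =
    walk-reaches deg root walk
      (m , trans (cong (λ a → iterate (parent c E) a m) (sym (parent-edge mem (deg _)))) hit)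
  walk-reaches {E} {c} deg root (bwd mem walk) (m , hit) =
    walk-reaches deg root walk
      (suc m , trans (cong (λ a → iterate (parent c E) a m) (parent-edge mem (deg _))) hit)

  no-walk-from-root : ∀ {E c z y} → (∀ x → outdeg x c E ≤ 1) → outdeg z c E ≡ 0 →
                      ¬ Reaches (parent c E) y z → ¬ Walk E c z y
  no-walk-from-root {E} deg root unreached walk =
    unreached (walk-reaches deg (parent-root E root) walk (0 , refl))

  walk-mono : ∀ {E E' : List Edge} {c x y} → (∀ {e} → e ∈ E → e ∈ E') → Walk E c x y → Walk E' c x y
  walk-mono sub here           = here
  walk-mono sub (fwd mem walk) = fwd (sub mem) (walk-mono sub walk)
  walk-mono sub (bwd mem walk) = bwd (sub mem) (walk-mono sub walk)

  -- Moving pebbles by canonical slides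

  -- One pebble has left a and one has arrived at b.
  record PebbleMoved (a b : Vertex) (s s' : Config) : Set where
    constructor pebbleMoved
    field shift : ∀ x → count (peb s') x + χ ⌊ x ≟ a ⌋ ≡ count (peb s) x + χ ⌊ x ≟ b ⌋
  open PebbleMoved

  PebbleMoved-trans : ∀ {a b c s t u} → PebbleMoved a b s t → PebbleMoved b c t u → PebbleMoved a c s u
  PebbleMoved-trans {a} {b} {c} {s} {t} {u} ab bc = pebbleMoved λ x →
    +-cancel-chain (count (peb s) x) (count (peb t) x) (count (peb u) x)
                   (χ ⌊ x ≟ a ⌋) (χ ⌊ x ≟ b ⌋) (χ ⌊ x ≟ c ⌋) (shift ab x) (shift bc x)

  sum-χ-∧ : ∀ b (c : Colour) → sum (λ d → χ (b ∧ ⌊ d ≟ c ⌋)) ≡ χ b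
  sum-χ-∧ b c = trans (sum-cong-≗ (λ d → χ-∧ b ⌊ d ≟ c ⌋)) (sum-δ c (λ _ → χ b))

  Slide-moves : ∀ {s s'} (sl : Slide s s') → PebbleMoved (Slide.w sl) (Slide.v sl) s s'
  Slide-moves {s} {s'} sl = pebbleMoved shift'
    where
    open Slide sl
    open ≡-Reasoning
    shift' : ∀ x → count (peb s') x + χ ⌊ x ≟ w ⌋ ≡ count (peb s) x + χ ⌊ x ≟ v ⌋
    shift' x = begin
        count (peb s') x + χ ⌊ x ≟ w ⌋
          ≡⟨ cong₂ _+_ (count≡sum (peb s') x) (sym (sum-χ-∧ ⌊ x ≟ w ⌋ c')) ⟩
        sum (peb s' x) + sum (λ d → χ (⌊ x ≟ w ⌋ ∧ ⌊ d ≟ c' ⌋))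
          ≡⟨ sym (∑-distrib-+ (peb s' x) _) ⟩
        sum (λ d → peb s' x d + χ (⌊ x ≟ w ⌋ ∧ ⌊ d ≟ c' ⌋))
          ≡⟨ sum-cong-≗ exchange-at ⟩
        sum (λ d → peb s x d + χ (⌊ x ≟ v ⌋ ∧ ⌊ d ≟ c ⌋))
          ≡⟨ ∑-distrib-+ (peb s x) _ ⟩
        sum (peb s x) + sum (λ d → χ (⌊ x ≟ v ⌋ ∧ ⌊ d ≟ c ⌋))
          ≡⟨ cong₂ _+_ (sym (count≡sum (peb s) x)) (sum-χ-∧ ⌊ x ≟ v ⌋ c) ⟩
        count (peb s) x + χ ⌊ x ≟ v ⌋ ∎
      where
      exchange-at : ∀ d → peb s' x d + χ (⌊ x ≟ w ⌋ ∧ ⌊ d ≟ c' ⌋) ≡ peb s x d + χ (⌊ x ≟ v ⌋ ∧ ⌊ d ≟ c ⌋)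
      exchange-at d = trans (cong (λ f → f x d + _) newPeb)
                            (exchange _ _ (peb s x d) (pebble-at (peb s) onW x d))

  record Transfer (s : Config) (a b : Vertex) : Set where
    field
      final  : Config
      slides : Slides s final
      moved  : PebbleMoved a b s final
  open Transfer

  stay : ∀ {s a} → Transfer s a a
  stay {s} = record { final = s ; slides = ε ; moved = pebbleMoved λ _ → refl }

  _▸_ : ∀ {s a b c} (T : Transfer s a b) → Transfer (final T) b c → Transfer s a c
  T ▸ U = record { final = final U ; slides = slides T ◅◅ slides U
                 ; moved = PebbleMoved-trans (moved T) (moved U) }

  record Delivery (t : Config) (c : Colour) (z y : Vertex) (Touched : Edge → Set) : Set where
    field
      transfer : Transfer t z y
      arrived  : 1 ≤ peb (final transfer) y c
      kept     : ∀ e → e ∈ edges t → Touched e ⊎ e ∈ edges (final transfer)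
  open Delivery

  reverse-edge : ∀ {t E₁ E₂ v w d c} → edges t ≡ E₁ ++ (v , w , d) ∷ E₂ → 1 ≤ peb t w c → v ≢ w →
                 ¬ Walk (E₁ ++ E₂) c w v → Delivery t d w v (_≡ (v , w , d))
  reverse-edge {t} {E₁} {E₂} {v} {w} {d} {c} split pos v≢w acyclic = record
    { transfer = record { final = t' ; slides = canonical ◅ ε ; moved = Slide-moves move }
    ; arrived  = addP-here (remP w c (peb t)) v d
    ; kept     = λ e mem → ∈-++-replace E₁ (subst (e ∈_) split mem) }
    where
    t' : Config
    t' = st (addP v d (remP w c (peb t))) (E₁ ++ (w , v , c) ∷ E₂)
    move : Slide t t'
    move = record { E₁ = E₁ ; E₂ = E₂ ; v = v ; w = w ; c = d ; c' = c ; oldE = split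
                  ; onW = pos ; newPeb = refl ; newE = refl }
    canonical : CanonSlide t t'
    canonical = record { move = move ; noCycle = [ v≢w , acyclic ]′ }

  -- Once the c-edge from y to its parent y₁ is removed, y has no c-parent, so
  -- a c-walk from y₁ back to y would force y = y₁.
  reverse-to-parent : ∀ {t} → Balanced t → ∀ {c y y₁} → (y , y₁ , c) ∈ edges t → 1 ≤ peb t y₁ c →
                      y ≢ y₁ → Delivery t c y₁ y (_≡ (y , y₁ , c))
  reverse-to-parent {t} bal {c} {y} {y₁} mem pos y≢y₁ with ∈-∃++ mem
  ... | E₁ , E₂ , split = reverse-edge split pos y≢y₁ acyclic
    where
    deg : ∀ x → outdeg x c (E₁ ++ E₂) ≤ 1
    deg x = ≤-trans (m≤n+m _ _) (subst (_≤ 1) (outdeg-remove split x c) (outdeg≤1 bal x c))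
    y₁-root : outdeg y₁ c (E₁ ++ E₂) ≡ 0
    y₁-root = m+n≡0⇒n≡0 _ (trans (sym (outdeg-remove split y₁ c)) (pebble⇒outdeg≡0 bal pos))
    y-root : outdeg y c (E₁ ++ E₂) ≡ 0
    y-root = n≤0⇒n≡0 (≤-pred (subst (_≤ 1)
               (trans (outdeg-remove split y c) (cong (λ b → χ b + outdeg y c (E₁ ++ E₂)) (isOut-self y y₁ c)))
               (outdeg≤1 bal y c)))
    acyclic : ¬ Walk (E₁ ++ E₂) c y₁ y
    acyclic = no-walk-from-root deg y₁-root λ (j , hit) →
      y≢y₁ (trans (sym (iterate-fixed _ (parent-root (E₁ ++ E₂) y-root) j)) hit)

  descend : ∀ {t} → Balanced t → ∀ {c z} → 1 ≤ peb t z c → ∀ y m → iterate (parent c (edges t)) y m ≡ z →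
            (∀ i → i < m → iterate (parent c (edges t)) y i ≢ z) →
            Delivery t c z y (λ e → ∃ λ i → i < m × src e ≡ iterate (parent c (edges t)) y i)
  descend bal pos y zero refl _ = record { transfer = stay ; arrived = pos ; kept = λ _ → inj₂ }
  descend {t} bal {c} {z} pos y (suc m) hit miss = record
    { transfer = transfer R ▸ transfer S
    ; arrived  = arrived S
    ; kept     = kept' }
    where
    P  = parent c (edges t)
    y₁ = P y
    R = descend bal pos y₁ m hit (λ i i<m → miss (suc i) (s≤s i<m))
    t₁ = final (transfer R)
    y-not-root : P y ≢ y
    y-not-root fixed = miss 0 z<s (trans (sym (iterate-fixed P fixed (suc m))) hit)
    edge : (y , y₁ , c) ∈ edges t
    edge = [ (λ fixed → ⊥-elim (y-not-root fixed)) , id ]′ (parent-∈ (edges t) y)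
    edge₁ : (y , y₁ , c) ∈ edges t₁
    edge₁ with kept R _ edge
    ... | inj₂ mem = mem
    ... | inj₁ (i , i<m , y≡) =
      contradiction (subst (λ a → iterate P a (m ∸ i) ≡ z) (sym y≡) (proj₂ (Reaches-iterate P (<⇒≤ i<m) hit)))
                    (miss (m ∸ i) (s≤s (m∸n≤m m i)))
    S = reverse-to-parent (Balanced-slides (slides (transfer R)) bal) edge₁ (arrived R) (y-not-root ∘ sym)
    kept' : ∀ e → e ∈ edges t → (∃ λ i → i < suc m × src e ≡ iterate P y i) ⊎ e ∈ edges (final (transfer S))
    kept' e mem with kept R e mem
    ... | inj₁ (i , i<m , src≡) = inj₁ (suc i , s≤s i<m , src≡)
    ... | inj₂ mem₁ with kept S e mem₁
    ...   | inj₁ refl = inj₁ (0 , z<s , refl)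
    ...   | inj₂ mem₂ = inj₂ mem₂

  data Path (E : List Edge) (x : Vertex) : Vertex → ℕ → Set where
    []   : Path E x x 0
    _∷ʳ_ : ∀ {y z c m} → Path E x y m → (y , z , c) ∈ E → Path E x z (suc m)

  AllOn : ∀ {E x y m} → (Vertex → Set) → Path E x y m → Set
  AllOn {x = x} P []           = P x
  AllOn         P (_∷ʳ_ {z = z} p _) = AllOn P p × P z

  last-on : ∀ {E x y m} {P : Vertex → Set} (p : Path E x y m) → AllOn P p → P y
  last-on []       Px         = Px
  last-on (p ∷ʳ _) (_ , Py)   = Py

  Path-transport : ∀ {E E' x y m} {P : Vertex → Set} →
                   (∀ {a b c} → (a , b , c) ∈ E → P a → P b → (a , b , c) ∈ E') →
                   (p : Path E x y m) → AllOn P p → Path E' x y m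
  Path-transport keep []       _           = []
  Path-transport keep (p ∷ʳ e) (on-p , Pz) = Path-transport keep p on-p ∷ʳ keep e (last-on p on-p) Pz

  -- Where a path first enters P; an entering edge is either an early one or
  -- the last one.
  data FirstIn (P : Vertex → Set) {E x} : ∀ {z m} → Path E x z m → Set where
    at-start : ∀ {z m} {p : Path E x z m} → P x → FirstIn P p
    entered  : ∀ {z m y y' c m'} {p : Path E x z m} (q : Path E x y m') → (y , y' , c) ∈ E → P y' →
               AllOn (λ a → ¬ P a) q → suc m' < m ⊎ (y' ≡ z × suc m' ≡ m) → FirstIn P p

  first-in : ∀ {P : Vertex → Set} → Decidable P → ∀ {E x z m} (p : Path E x z m) →
             AllOn (λ a → ¬ P a) p ⊎ FirstIn P p
  first-in P? {x = x} [] with P? x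
  ... | yes Px = inj₂ (at-start Px)
  ... | no ¬Px = inj₁ ¬Px
  first-in P? (_∷ʳ_ {z = z} p e) with first-in P? p
  ... | inj₂ (at-start Px)                        = inj₂ (at-start Px)
  ... | inj₂ (entered q e' Py' off (inj₁ early))  = inj₂ (entered q e' Py' off (inj₁ (m<n⇒m<1+n early)))
  ... | inj₂ (entered q e' Py' off (inj₂ (refl , refl))) = inj₂ (entered q e' Py' off (inj₁ (n<1+n _)))
  ... | inj₁ off with P? z
  ...   | yes Pz = inj₂ (entered p e Pz off (inj₂ (refl , refl)))
  ...   | no ¬Pz = inj₁ (off , ¬Pz)

  module Tree {t} (bal : Balanced t) {z c} (pz : 1 ≤ peb t z c) where

    P : Vertex → Vertex
    P = parent c (edges t)

    root : P z ≡ z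
    root = parent-root (edges t) (pebble⇒outdeg≡0 bal pz)

    -- n steps suffice to reach the root (iterate-within), which makes this decidable.
    InTree : Vertex → Set
    InTree a = iterate P a n ≡ z

    InTree? : Decidable InTree
    InTree? a = iterate P a n ≟ z

    z-in-tree : InTree z
    z-in-tree = iterate-fixed P root n

    deliver : ∀ a → InTree a → Delivery t c z a (λ e → InTree (src e))
    deliver a a-in with first-hit P _≟_ a n a-in
    ... | j , hit , miss = record
      { transfer = transfer D ; arrived = arrived D ; kept = λ e mem → ⊎-map₁ (in-tree {e}) (kept D e mem) }
      where
      D = descend bal pz a j hit miss
      in-tree : ∀ {e} → (∃ λ i → i < j × src e ≡ iterate P a i) → InTree (src e)
      in-tree {e} (i , i<j , src≡) with r , hit' ← Reaches-iterate P (<⇒≤ i<j) hit =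
        iterate-within P root (src e) r (subst (λ b → iterate P b r ≡ z) (sym src≡) hit')

    reverse-into-root : ∀ {y d} → (y , z , d) ∈ edges t → ¬ InTree y → Delivery t d z y (_≡ (y , z , d))
    reverse-into-root {y} mem y-out with ∈-∃++ mem
    ... | E₁ , E₂ , split = reverse-edge split pz (λ { refl → y-out z-in-tree }) acyclic
      where
      acyclic : ¬ Walk (E₁ ++ E₂) c z y
      acyclic walk = no-walk-from-root (λ x → outdeg≤1 bal x c) (pebble⇒outdeg≡0 bal pz)
        (λ (j , hit) → y-out (iterate-within P root y j hit))
        (walk-mono (λ mem' → subst (_ ∈_) (sym split) (∈-++-insert E₁ mem')) walk)

  pull : ∀ fuel {t} → Balanced t → ∀ {x z m} → Path (edges t) x z m → m ≤ fuel →
         1 ≤ count (peb t) z → Transfer t z x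
  pull _       _ []       _  _ = stay
  pull zero    _ (_ ∷ʳ _) () _
  pull (suc f) {t} bal {z = z} p m≤fuel loaded
    with c , pz ← sum-positive (peb t z) (subst (1 ≤_) (count≡sum (peb t) z) loaded)
    with first-in (Tree.InTree? bal pz) p
  ... | inj₁ off = ⊥-elim (last-on p off (Tree.z-in-tree bal pz))
  ... | inj₂ (at-start x-in) = transfer (Tree.deliver bal pz _ x-in)
  ... | inj₂ (entered {y' = y'} q e y'-in off (inj₁ early)) =
    transfer D ▸ pull f (Balanced-slides (slides (transfer D)) bal) (q' ∷ʳ keep e (last-on q off))
                      (≤-pred (≤-trans early m≤fuel)) (count-≥ (peb (final (transfer D))) y' c (arrived D))
    where
    D = Tree.deliver bal pz y' y'-in
    keep : ∀ {a b d} → (a , b , d) ∈ edges t → ¬ Tree.InTree bal pz a → (a , b , d) ∈ edges (final (transfer D))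
    keep mem a-out = [ (λ a-in → contradiction a-in a-out) , id ]′ (kept D _ mem)
    q' = Path-transport (λ mem a-out _ → keep mem a-out) q off
  ... | inj₂ (entered {y = y} {c = d} q e z-in off (inj₂ (refl , refl))) =
    transfer D ▸ pull f (Balanced-slides (slides (transfer D)) bal) q' (≤-pred m≤fuel)
                      (count-≥ (peb (final (transfer D))) y d (arrived D))
    where
    D = Tree.reverse-into-root bal pz e (last-on q off)
    q' = Path-transport (λ mem _ b-out → [ (λ { refl → contradiction z-in b-out }) , id ]′ (kept D _ mem)) q off

  -- Searching outwards from {v, w}

  pair : Vertex → Vertex → Vertex → Bool
  pair v w x = ⌊ x ≟ v ⌋ ∨ ⌊ x ≟ w ⌋

  record Escape (t : Config) (v w : Vertex) : Set where
    field
      start end : Vertex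
      length    : ℕ
      path      : Path (edges t) start end length
      from      : pair v w start ≡ true
      outside   : pair v w end ≡ false
      loaded    : 1 ≤ count (peb t) end

  record Explored (t : Config) (v w : Vertex) (X : Vertex → Bool) : Set where
    field
      ⊇pair   : ∀ x → pair v w x ≡ true → X x ≡ true
      reached : ∀ x → X x ≡ true → ∃₂ λ a m → pair v w a ≡ true × Path (edges t) a x m
      empty   : ∀ x → X x ≡ true → pair v w x ≡ true ⊎ count (peb t) x ≡ 0
  open Explored

  record Trap (t : Config) (v w : Vertex) : Set where
    field
      X        : Vertex → Bool
      explored : Explored t v w X
      closed   : ∀ {a b d} → (a , b , d) ∈ edges t → X a ≡ true → X b ≡ true

  Explored-pair : ∀ {t v w} → Explored t v w (pair v w)
  Explored-pair = record
    { ⊇pair = λ _ → id ; reached = λ x in-pair → x , 0 , in-pair , [] ; empty = λ _ → inj₁ }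

  Explored-grow : ∀ {t v w X a b d} → Explored t v w X → (a , b , d) ∈ edges t → X a ≡ true →
                  count (peb t) b ≡ 0 → Explored t v w (λ x → X x ∨ ⌊ x ≟ b ⌋)
  Explored-grow {t} {v} {w} {X} {a} {b} ex mem Xa unloaded = record
    { ⊇pair   = λ x in-pair → cong (_∨ ⌊ x ≟ b ⌋) (⊇pair ex x in-pair)
    ; reached = λ x → [ reached ex x , (λ { refl → extend }) ]′ ∘ split x
    ; empty   = λ x → [ empty ex x , (λ { refl → inj₂ unloaded }) ]′ ∘ split x }
    where
    split : ∀ x → X x ∨ ⌊ x ≟ b ⌋ ≡ true → X x ≡ true ⊎ x ≡ b
    split x h with X x
    ... | true  = inj₁ refl
    ... | false = inj₂ (⌊≟⌋-true h)
    extend : ∃₂ λ a' m → pair v w a' ≡ true × Path (edges t) a' b m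
    extend with reached ex a Xa
    ... | a' , m , in-pair , p = a' , suc m , in-pair , p ∷ʳ mem

  outside-explored : ∀ {t v w X x} → Explored t v w X → X x ≡ false → pair v w x ≡ false
  outside-explored {v = v} {w} {x = x} ex Xx with pair v w x in px
  ... | true  = contradiction (trans (sym Xx) (⊇pair ex x px)) λ ()
  ... | false = refl

  unexplored : (Vertex → Bool) → ℕ
  unexplored X = sum (λ x → χ (not (X x)))

  unexplored-grow : ∀ X b → X b ≡ false → unexplored (λ x → X x ∨ ⌊ x ≟ b ⌋) < unexplored X
  unexplored-grow X b Xb = sum-mono-< pointwise b strict
    where
    pointwise : ∀ x → χ (not (X x ∨ ⌊ x ≟ b ⌋)) ≤ χ (not (X x))
    pointwise x with X x
    ... | true  = z≤n
    ... | false = χ≤1 _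
    strict : χ (not (X b ∨ ⌊ b ≟ b ⌋)) < χ (not (X b))
    strict rewrite Xb | ⌊≟⌋-diag b = s≤s z≤n

  explore : ∀ {t v w} fuel X → unexplored X ≤ fuel → Explored t v w X → Escape t v w ⊎ Trap t v w
  explore {t} fuel X bound ex
    with any? (λ e → (X (src e) ≟ᵇ true) ×-dec (X (tgt e) ≟ᵇ false)) (edges t)
  ... | no none = inj₂ (record { X = X ; explored = ex ; closed = closed })
    where
    closed : ∀ {a b d} → (a , b , d) ∈ edges t → X a ≡ true → X b ≡ true
    closed {b = b} mem Xa with X b in Xb
    ... | true  = refl
    ... | false = contradiction (lose mem (Xa , Xb)) none
  ... | yes leaving with find leaving
  ...   | (a , b , d) , mem , Xa , Xb with 1 ≤? count (peb t) b
  ...     | yes loaded with reached ex a Xa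
  ...       | a' , m , in-pair , p = inj₁ (record
              { start = a' ; end = b ; length = suc m ; path = p ∷ʳ mem ; from = in-pair
              ; outside = outside-explored ex Xb ; loaded = loaded })
  explore {t} fuel X bound ex | yes _ | (a , b , d) , mem , Xa , Xb | no unloaded
    with fuel | ≤-trans (unexplored-grow X b Xb) bound
  ... | suc f | s≤s bound' = explore f _ bound' (Explored-grow ex mem Xa (n≤0⇒n≡0 (≤-pred (≰⇒> unloaded))))

  search : ∀ t v w → Escape t v w ⊎ Trap t v w
  search t v w = explore n (pair v w) bound Explored-pair
    where
    bound : unexplored (pair v w) ≤ n
    bound = ≤-trans (sum-mono-≤ (λ x → χ≤1 (not (pair v w x)))) (≤-reflexive (sum-ones n))

  -- Counting pebbles on a closed set

  sumOver : (Vertex → Bool) → (Vertex → ℕ) → ℕ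
  sumOver X f = sum (λ x → if X x then f x else 0)

  sumOver-cong : ∀ X {f g} → (∀ x → f x ≡ g x) → sumOver X f ≡ sumOver X g
  sumOver-cong X f≡g = sum-cong-≗ (λ x → cong (λ a → if X x then a else 0) (f≡g x))

  sumOver-+ : ∀ X f g → sumOver X (λ x → f x + g x) ≡ sumOver X f + sumOver X g
  sumOver-+ X f g =
    trans (sum-cong-≗ split) (∑-distrib-+ (λ x → if X x then f x else 0) (λ x → if X x then g x else 0))
    where
    split : ∀ x → (if X x then f x + g x else 0) ≡ (if X x then f x else 0) + (if X x then g x else 0)
    split x with X x
    ... | true  = refl
    ... | false = refl

  sumOver-⊆ : ∀ {X Y} f → (∀ x → X x ≡ true → Y x ≡ true) → sumOver X f ≤ sumOver Y f
  sumOver-⊆ {X} {Y} f X⊆Y = sum-mono-≤ pointwise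
    where
    pointwise : ∀ x → (if X x then f x else 0) ≤ (if Y x then f x else 0)
    pointwise x with X x in Xx
    ... | false = z≤n
    ... | true rewrite X⊆Y x Xx = ≤-refl

  sumOver-δ : ∀ X a → sumOver X (λ x → χ ⌊ x ≟ a ⌋) ≡ χ (X a)
  sumOver-δ X a = trans (sum-cong-≗ swap-tests) (sum-δ a (χ ∘ X))
    where
    swap-tests : ∀ x → (if X x then χ ⌊ x ≟ a ⌋ else 0) ≡ (if ⌊ x ≟ a ⌋ then χ (X x) else 0)
    swap-tests x with X x | ⌊ x ≟ a ⌋
    ... | true  | true  = refl
    ... | true  | false = refl
    ... | false | true  = refl
    ... | false | false = refl

  sumOver-moved : ∀ {a b s s'} → PebbleMoved a b s s' → ∀ X →
                  sumOver X (count (peb s')) + χ (X a) ≡ sumOver X (count (peb s)) + χ (X b)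
  sumOver-moved {a} {b} {s} {s'} mv X = begin
    sumOver X (count (peb s')) + χ (X a)                        ≡⟨ cong (_ +_) (sym (sumOver-δ X a)) ⟩
    sumOver X (count (peb s')) + sumOver X (λ x → χ ⌊ x ≟ a ⌋)  ≡⟨ sym (sumOver-+ X _ _) ⟩
    sumOver X (λ x → count (peb s') x + χ ⌊ x ≟ a ⌋)           ≡⟨ sumOver-cong X (shift mv) ⟩
    sumOver X (λ x → count (peb s) x + χ ⌊ x ≟ b ⌋)            ≡⟨ sumOver-+ X _ _ ⟩
    sumOver X (count (peb s)) + sumOver X (λ x → χ ⌊ x ≟ b ⌋)   ≡⟨ cong (_ +_) (sumOver-δ X b) ⟩
    sumOver X (count (peb s)) + χ (X b)                         ∎
    where open ≡-Reasoning

  countSet≡sumOver : ∀ (f : Vertex → Colour → ℕ) v w → countSet f v w ≡ sumOver (pair v w) (count f)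
  countSet≡sumOver f v w with v ≟ w
  ... | yes refl = sym (trans (sum-cong-≗ (λ x → cong (λ b → if b then count f x else 0) (∨-idem ⌊ x ≟ v ⌋)))
                              (sum-δ v (count f)))
  ... | no v≢w = sym (trans (sum-cong-≗ split)
                            (trans (∑-distrib-+ (at v) (at w)) (cong₂ _+_ (sum-δ v (count f)) (sum-δ w (count f)))))
    where
    at : Vertex → Vertex → ℕ
    at y x = if ⌊ x ≟ y ⌋ then count f x else 0
    split : ∀ x → (if pair v w x then count f x else 0) ≡ at v x + at w x
    split x with x ≟ v | x ≟ w
    ... | yes refl | yes refl = contradiction refl v≢w
    ... | yes _    | no _     = sym (+-identityʳ _)
    ... | no _     | _        = refl

  countSet-moved : ∀ {s s' a b v w} → PebbleMoved a b s s' → pair v w a ≡ false → pair v w b ≡ true →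
                   countSet (peb s') v w ≡ suc (countSet (peb s) v w)
  countSet-moved {s} {s'} {a} {b} {v} {w} mv a-out b-in = begin
    countSet (peb s') v w                                   ≡⟨ countSet≡sumOver (peb s') v w ⟩
    sumOver (pair v w) (count (peb s'))                     ≡⟨ sym (+-identityʳ _) ⟩
    sumOver (pair v w) (count (peb s')) + χ false           ≡⟨ cong (λ β → _ + χ β) (sym a-out) ⟩
    sumOver (pair v w) (count (peb s')) + χ (pair v w a)    ≡⟨ sumOver-moved mv (pair v w) ⟩
    sumOver (pair v w) (count (peb s)) + χ (pair v w b)     ≡⟨ cong (λ β → _ + χ β) b-in ⟩
    sumOver (pair v w) (count (peb s)) + 1                  ≡⟨ +-comm _ 1 ⟩
    suc (sumOver (pair v w) (count (peb s)))                ≡⟨ cong suc (sym (countSet≡sumOver (peb s) v w)) ⟩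
    suc (countSet (peb s) v w)                              ∎
    where open ≡-Reasoning

  pebbles+outdeg : ∀ {s} → Balanced s → ∀ x → count (peb s) x + tally (λ e → ⌊ x ≟ src e ⌋) (edges s) ≡ k
  pebbles+outdeg {s} bal x = begin
    count (peb s) x + tally (λ e → ⌊ x ≟ src e ⌋) (edges s)
      ≡⟨ cong₂ _+_ (count≡sum (peb s) x) (sym (sum-tally col (λ _ e → ⌊ x ≟ src e ⌋) (edges s))) ⟩
    sum (peb s x) + sum (λ d → outdeg x d (edges s))
      ≡⟨ sym (∑-distrib-+ (peb s x) (λ d → outdeg x d (edges s))) ⟩
    sum (λ d → peb s x d + outdeg x d (edges s))
      ≡⟨ sum-cong-≗ (balance bal x) ⟩
    sum {k} (λ _ → 1)
      ≡⟨ sum-ones k ⟩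
    k ∎
    where open ≡-Reasoning

  pebbles+out : ∀ {s} → Balanced s → ∀ X →
                sumOver X (count (peb s)) + tally (X ∘ src) (edges s) ≡ sumOver X (λ _ → k)
  pebbles+out {s} bal X = begin
    sumOver X (count (peb s)) + tally (X ∘ src) (edges s)
      ≡⟨ cong (sumOver X (count (peb s)) +_) (sym (sum-tally src (λ x _ → X x) (edges s))) ⟩
    sumOver X (count (peb s)) + sum (λ x → tally (λ e → X x ∧ ⌊ x ≟ src e ⌋) (edges s))
      ≡⟨ sym (∑-distrib-+ (λ x → if X x then count (peb s) x else 0)
                          (λ x → tally (λ e → X x ∧ ⌊ x ≟ src e ⌋) (edges s))) ⟩
    sum (λ x → (if X x then count (peb s) x else 0) + tally (λ e → X x ∧ ⌊ x ≟ src e ⌋) (edges s))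
      ≡⟨ sum-cong-≗ per-vertex ⟩
    sumOver X (λ _ → k) ∎
    where
    open ≡-Reasoning
    per-vertex : ∀ x → (if X x then count (peb s) x else 0) + tally (λ e → X x ∧ ⌊ x ≟ src e ⌋) (edges s) ≡
                       (if X x then k else 0)
    per-vertex x with X x
    ... | true  = pebbles+outdeg bal x
    ... | false = tally-false (edges s)

  both : (Vertex → Bool) → Vertex × Vertex → Bool
  both X (a , b) = X a ∧ X b

  both-norm : ∀ X a b → both X (norm (a , b)) ≡ X a ∧ X b
  both-norm X a b with toℕ a ≤? toℕ b
  ... | yes _ = refl
  ... | no  _ = ∧-comm (X b) (X a)

  inside : (Vertex → Bool) → List Edge → ℕ
  inside X = tally (λ e → X (src e) ∧ X (tgt e))

  inside-underlying : ∀ X s → inside X (edges s) ≡ tally (both X) (map norm (underlying s))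
  inside-underlying X s =
    trans (tally-cong (edges s) (λ e _ → sym (both-norm X (src e) (tgt e))))
          (trans (sym (tally-map (both X) edgeNorm (edges s))) (cong (tally (both X)) (sym (underlying-norm s))))

  inside-sameGraph : ∀ X {s t} → SameGraph (underlying t) (underlying s) →
                     inside X (edges t) ≡ inside X (edges s)
  inside-sameGraph X {s} {t} same =
    trans (inside-underlying X t) (trans (tally-↭ (both X) same) (sym (inside-underlying X s)))

  closed-pebbles : ∀ {s t} X → Balanced s → Balanced t → SameGraph (underlying t) (underlying s) →
                   (∀ {a b d} → (a , b , d) ∈ edges t → X a ≡ true → X b ≡ true) →
                   sumOver X (count (peb s)) ≤ sumOver X (count (peb t))
  closed-pebbles {s} {t} X bal-s bal-t same closed = +-cancelʳ-≤ (out s) _ _ (begin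
    sumOver X (count (peb s)) + out s
      ≡⟨ trans (pebbles+out bal-s X) (sym (pebbles+out bal-t X)) ⟩
    sumOver X (count (peb t)) + out t
      ≡⟨ cong (sumOver X (count (peb t)) +_) out≡inside ⟩
    sumOver X (count (peb t)) + inside X (edges s)
      ≤⟨ +-monoʳ-≤ _ (tally-mono (λ e → χ-∧-≤ (X (src e)) (X (tgt e))) (edges s)) ⟩
    sumOver X (count (peb t)) + out s ∎)
    where
    open ≤-Reasoning
    out : Config → ℕ
    out u = tally (X ∘ src) (edges u)
    stays-inside : ∀ e → e ∈ edges t → X (src e) ≡ X (src e) ∧ X (tgt e)
    stays-inside (a , b , d) mem with X a in Xa
    ... | true  = sym (closed mem Xa)
    ... | false = refl
    out≡inside : out t ≡ inside X (edges s)
    out≡inside = trans (tally-cong (edges t) stays-inside) (inside-sameGraph X {s} {t} same)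

  trap-bound : ∀ {s t v w} → Balanced s → Balanced t → SameGraph (underlying t) (underlying s) →
               Trap t v w → countSet (peb s) v w ≤ countSet (peb t) v w
  trap-bound {s} {t} {v} {w} bal-s bal-t same trap = begin
    countSet (peb s) v w                ≡⟨ countSet≡sumOver (peb s) v w ⟩
    sumOver (pair v w) (count (peb s))  ≤⟨ sumOver-⊆ (count (peb s)) (⊇pair explored) ⟩
    sumOver X (count (peb s))           ≤⟨ closed-pebbles X bal-s bal-t same closed ⟩
    sumOver X (count (peb t))           ≡⟨ sum-cong-≗ only-pair ⟩
    sumOver (pair v w) (count (peb t))  ≡⟨ sym (countSet≡sumOver (peb t) v w) ⟩
    countSet (peb t) v w                ∎
    where
    open Trap trap
    open ≤-Reasoning
    only-pair : ∀ x → (if X x then count (peb t) x else 0) ≡ (if pair v w x then count (peb t) x else 0)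
    only-pair x with X x in Xx | pair v w x in px
    ... | true  | true  = refl
    ... | true  | false = [ (λ p → contradiction (trans (sym px) p) λ ()) , id ]′ (empty explored x Xx)
    ... | false | true  = contradiction (trans (sym Xx) (⊇pair explored x px)) λ ()
    ... | false | false = refl

  -- Simulating a construction canonically

  gather : ∀ {ℓ s} v w → Balanced s → ℓ + 1 ≤ countSet (peb s) v w →
           ∀ deficit {t} → Balanced t → SameGraph (underlying t) (underlying s) →
           ℓ + 1 ≤ deficit + countSet (peb t) v w →
           Σ[ t' ∈ Config ] Slides t t' × ℓ + 1 ≤ countSet (peb t') v w
  gather v w bal-s enough zero {t} bal-t same ok = t , ε , ok
  gather {ℓ} v w bal-s enough (suc d) {t} bal-t same ok with ℓ + 1 ≤? countSet (peb t) v w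
  ... | yes ok' = t , ε , ok'
  ... | no short with search t v w
  ...   | inj₂ trap = contradiction (≤-trans enough (trap-bound bal-s bal-t same trap)) short
  ...   | inj₁ esc =
    let t' , run , ok' = gather v w bal-s enough d (Balanced-slides (slides T) bal-t)
                                (↭-trans (Slides-sameGraph (slides T)) same) ok₁
    in t' , slides T ◅◅ run , ok'
    where
    open Escape esc
    T = pull length bal-t path ≤-refl loaded
    ok₁ : ℓ + 1 ≤ d + countSet (peb (final T)) v w
    ok₁ = subst (ℓ + 1 ≤_) (sym (trans (cong (d +_) (countSet-moved (moved T) outside from)) (+-suc d _))) ok

  countSet-sym : ∀ (f : Vertex → Colour → ℕ) v w → countSet f v w ≡ countSet f w v
  countSet-sym f v w with v ≟ w | w ≟ v
  ... | yes refl | yes _    = refl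
  ... | yes v≡w  | no  w≢v  = contradiction (sym v≡w) w≢v
  ... | no  v≢w  | yes w≡v  = contradiction (sym w≡v) v≢w
  ... | no  _    | no  _    = +-comm (count f v) (count f w)

  pebble-on-pair : ∀ (f : Vertex → Colour → ℕ) v w → 1 ≤ countSet f v w → ∃ λ d → Present f v d ⊎ Present f w d
  pebble-on-pair f v w pos with v ≟ w
  ... | yes refl = map₂ inj₁ (sum-positive (f v) (subst (1 ≤_) (count≡sum f v) pos))
  ... | no _ with count f v in cv
  ...   | suc _ = map₂ inj₁ (sum-positive (f v) (subst (1 ≤_) (trans (sym cv) (count≡sum f v)) (s≤s z≤n)))
  ...   | zero  = map₂ inj₂ (sum-positive (f w) (subst (1 ≤_) (count≡sum f w) pos))

  record AddsEdge (v w : Vertex) (s s' : Config) : Set where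
    constructor adds
    field
      {edge}    : Edge
      extended  : edges s' ≡ edge ∷ edges s
      same-ends : edgeNorm edge ≡ norm (v , w)

  AddsEdge-norm : ∀ {v w} {s s' : Config} → AddsEdge v w s s' →
                  map norm (underlying s') ≡ norm (v , w) ∷ map norm (underlying s)
  AddsEdge-norm {s = s} {s'} (adds new e≈vw) =
    trans (underlying-norm s') (trans (cong (map edgeNorm) new) (cong₂ _∷_ e≈vw (sym (underlying-norm s))))

  sameGraph-add : ∀ {v w} {s s' t t' : Config} → SameGraph (underlying t) (underlying s) →
                  AddsEdge v w t t' → AddsEdge v w s s' → SameGraph (underlying t') (underlying s')
  sameGraph-add same t→t' s→s' =
    ↭-trans (↭-reflexive (AddsEdge-norm t→t')) (↭-trans (prep _ same) (↭-reflexive (sym (AddsEdge-norm s→s'))))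

  AddEdge-adds : ∀ {ℓ} {s s' : Config} (mv : AddEdge ℓ s s') → AddsEdge (AddEdge.v mv) (AddEdge.w mv) s s'
  AddEdge-adds mv = adds (AddEdge.newE mv) refl

  add-move : ∀ {ℓ} {t : Config} v w c → Present (peb t) v c → ℓ + 1 ≤ countSet (peb t) v w →
             AddEdge ℓ t (st (remP v c (peb t)) ((v , w , c) ∷ edges t))
  add-move v w c pos enough =
    record { v = v ; w = w ; c = c ; onV = pos ; enough = enough ; newPeb = refl ; newE = refl }

  canonical-add : ∀ {ℓ} {t : Config} v w → ℓ + 1 ≤ countSet (peb t) v w →
                  Σ[ t' ∈ Config ] CanonStep ℓ t t' × AddsEdge v w t t'
  canonical-add {ℓ} {t} v w enough with anyFin? (λ d → (1 ≤? peb t v d) ×-dec (1 ≤? peb t w d))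
  ... | yes (d , pv , pw) = _ , add (record { move = add-move v w d pv enough ; canon = inj₁ pw }) , adds refl refl
  ... | no none with max-such-that (λ d → (1 ≤? peb t v d) ⊎-dec (1 ≤? peb t w d))
                                   (pebble-on-pair (peb t) v w (≤-trans (m≤n+m 1 ℓ) enough))
  ...   | d , inj₁ pv , top =
    _ , add (record { move = add-move v w d pv enough ; canon = inj₂ ((λ d' both → none (d' , both)) , top) })
      , adds refl refl
  ...   | d , inj₂ pw , top =
    _ , add (record { move = add-move w v d pw (subst (ℓ + 1 ≤_) (countSet-sym (peb t) v w) enough)
                    ; canon = inj₂ ((λ { d' (pw' , pv') → none (d' , pv' , pw') }) , (λ d' → top d' ∘ ⊎-swap)) })
      , adds refl (norm-swap w v)

  forget : ∀ {ℓ} {s s' : Config} → CanonStep ℓ s s' → Step ℓ s s'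
  forget (add a)    = add (CanonAddEdge.move a)
  forget (slide sl) = slide (CanonSlide.move sl)

  simulate : ∀ {ℓ s₀ s} → Balanced s₀ → Star (Step ℓ) s₀ s →
             ∀ {t} → Balanced t → SameGraph (underlying t) (underlying s₀) →
             Σ[ t' ∈ Config ] Star (CanonStep ℓ) t t' × SameGraph (underlying t') (underlying s)
  simulate _ ε {t} _ same = t , ε , same
  simulate bal-s (slide sl ◅ run) bal-t same =
    simulate (Balanced-slide sl bal-s) run bal-t (↭-trans same (↭-sym (Slide-sameGraph sl)))
  simulate {ℓ} bal-s (add mv ◅ run) bal-t same =
    let t₁ , gathered , enough₁ = gather v w bal-s enough (ℓ + 1) bal-t same (m≤m+n (ℓ + 1) _)
        t₂ , step , added       = canonical-add v w enough₁
        t' , run' , same'       = simulate (Balanced-add mv bal-s) run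
                                    (Balanced-step (forget step) (Balanced-slides gathered bal-t))
                                    (sameGraph-add (↭-trans (Slides-sameGraph gathered) same)
                                                   added (AddEdge-adds mv))
    in t' , Star.map {U = CanonStep ℓ} slide gathered ◅◅ step ◅ run' , same'
    where open AddEdge mv

lemma10 : ∀ {n : ℕ} (k ℓ : ℕ) → ℓ < 2 * k → (G : List (Fin n × Fin n))
            → PebbleGameGraph k ℓ G → HasCanonicalConstruction k ℓ G
lemma10 {n} k ℓ _ _ (s , run , s≈G) =
  let t , canonical , t≈s = simulate Balanced-initial run Balanced-initial ↭-refl
  in t , canonical , ↭-trans t≈s s≈G
  where open Game n k
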